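{- Let $n\ge1$, $d$ a positive divisor of $n$, $C$ the cyclic shift $C(x_0,\dots,x_{n-1})=(x_1,\dots,x_{n-1},x_0)$ on $\mathbb{Z}_2^n$, $X=(-1,+1,\dots,+1)$, $A_{i,d}X=\prod_{j=0}^{n/d-1}C^{i+jd}X$ for $0\le i\le d-1$, and $\mathbb{G}_d(n)$ the subgroup of $\mathbb{Z}_2^n$ generated by $\{A_{0,d}X,\dots,A_{d-1,d}X\}$. Then $\mathbb{G}_d(n)$ is an $S$-subgroup of the Schur ring $\mathfrak{S}(\mathbb{Z}_2^n,C_n)$, i.e. $\mathbb{G}_d(n)$ is a union of orbits of the cyclic group $C_n=\langle C\rangle$.
   Context: $\mathbb{Z}_2^n$ is the group of $\pm1$ sequences of length $n$ under coordinatewise multiplication. $\mathfrak{S}(\mathbb{Z}_2^n,C_n)$ is the Schur ring whose basic sets are the $C_n$-orbits on $\mathbb{Z}_2^n$; an $S$-subgroup is a subgroup that is a union of basic sets. -}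

module Defs where

open import Data.Nat using (ℕ; zero; suc; _+_; _*_; _/_; _%_; NonZero)
open import Data.Nat.Divisibility using (_∣_)
open import Data.Bool using (Bool; true; false; _xor_)
open import Data.Fin using (Fin; toℕ; fromℕ<)
open import Data.Nat.DivMod using (m%n<n)
open import Data.Product using (∃; Σ)
open import Relation.Binary.PropositionalEquality using (_≡_)

-- Elements of ℤ₂ⁿ: functions Fin n → Bool, with  true  encoding -1
-- and  false  encoding +1.  Coordinatewise multiplication of ±1 is xor.
Z2^ : ℕ → Set
Z2^ n = Fin n → Bool

_≈_ : ∀ {n} → Z2^ n → Z2^ n → Set
x ≈ y = ∀ i → x i ≡ y i

_·_ : ∀ {n} → Z2^ n → Z2^ n → Z2^ n
(x · y) i = x i xor y i

one : ∀ {n} → Z2^ n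
one _ = false

inv : ∀ {n} → Z2^ n → Z2^ n
inv x = x

_⊕_ : ∀ {n} {{_ : NonZero n}} → Fin n → ℕ → Fin n
_⊕_ {n} i k = fromℕ< (m%n<n (toℕ i + k) n)

C : ∀ {n} {{_ : NonZero n}} → Z2^ n → Z2^ n
C x j = x (j ⊕ 1)

C^ : ∀ {n} {{_ : NonZero n}} → ℕ → Z2^ n → Z2^ n
C^ zero    x = x
C^ (suc k) x = C (C^ k x)

X : ∀ {n} → Z2^ n
X i with toℕ i
... | zero  = true
... | suc _ = false

prod : ∀ {n} → ℕ → (ℕ → Z2^ n) → Z2^ n
prod zero    f = one
prod (suc m) f = prod m f · f m

A : ∀ {n} {{_ : NonZero n}} (d : ℕ) {{_ : NonZero d}} → ℕ → Z2^ n
A {n} d i = prod (n / d) (λ j → C^ (i + j * d) X)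

data ⟨_⟩ {n : ℕ} {I : Set} (g : I → Z2^ n) : Z2^ n → Set where
  gen   : ∀ i → ⟨ g ⟩ (g i)
  unit  : ⟨ g ⟩ one
  mul   : ∀ {x y} → ⟨ g ⟩ x → ⟨ g ⟩ y → ⟨ g ⟩ (x · y)
  inverse : ∀ {x} → ⟨ g ⟩ x → ⟨ g ⟩ (inv x)
  resp  : ∀ {x y} → x ≈ y → ⟨ g ⟩ x → ⟨ g ⟩ y

G : (n : ℕ) {{_ : NonZero n}} (d : ℕ) {{_ : NonZero d}} → Z2^ n → Set
G n d = ⟨ (λ (i : Fin d) → A {n} d (toℕ i)) ⟩

InOrbit : ∀ {n} {{_ : NonZero n}} → Z2^ n → Z2^ n → Set
InOrbit x y = ∃ λ k → y ≈ C^ k x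

UnionOfOrbits : ∀ {n} {{_ : NonZero n}} → (Z2^ n → Set) → Set
UnionOfOrbits H = ∀ x y → H x → InOrbit x y → H y

module Submission where

-- Since C is an automorphism of ℤ₂ⁿ, the subgroup generated by a family is C-invariant as soon as
-- C maps every generator into it, and then it is closed under all of C_n = ⟨C⟩. For the generators
-- A_{i,d}X one has C(A_{i,d}X) = A_{i+1,d}X, and C(A_{d-1,d}X) = ∏_j C^{(j+1)d}X = A_{0,d}X,
-- because C^{(n/d)d} = C^n is the identity, so the last factor wraps around to the first.

open import Defs
open import Data.Nat using (ℕ; NonZero; zero; suc; _+_; _*_; _%_; _/_; _<_; >-nonZero⁻¹)
open import Data.Nat.Divisibility using (_∣_)
open import Data.Nat.DivMod using (%-distribˡ-+; m%n%n≡m%n; [m+n]%n≡m%n; m<n⇒m%n≡m; m/n*n≡m)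
open import Data.Nat.Properties using (_≟_; +-assoc; +-identityʳ; ≤∧≢⇒<)
open import Data.Bool using (false; true; _xor_)
open import Data.Bool.Properties using (xor-assoc; xor-comm; xor-identityʳ; not-injective)
open import Data.Fin using (Fin; toℕ; fromℕ<)
open import Data.Fin.Properties using (toℕ-fromℕ<; toℕ-injective; toℕ<n)
open import Data.Product using (_,_)
open import Relation.Nullary using (yes; no)
open import Relation.Binary.PropositionalEquality hiding (resp)
open ≡-Reasoning

[m%n+k]%n≡[m+k]%n : ∀ m k n .{{_ : NonZero n}} → (m % n + k) % n ≡ (m + k) % n
[m%n+k]%n≡[m+k]%n m k n = begin
  (m % n + k) % n          ≡⟨ %-distribˡ-+ (m % n) k n ⟩
  (m % n % n + k % n) % n  ≡⟨ cong (λ v → (v + k % n) % n) (m%n%n≡m%n m n) ⟩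
  (m % n + k % n) % n      ≡⟨ %-distribˡ-+ m k n ⟨
  (m + k) % n              ∎

xor-cancelʳ : ∀ {a b} c → a xor c ≡ b xor c → a ≡ b
xor-cancelʳ {a} {b} false e = begin
  a           ≡⟨ xor-identityʳ a ⟨
  a xor false ≡⟨ e ⟩
  b xor false ≡⟨ xor-identityʳ b ⟩
  b           ∎
xor-cancelʳ {a} {b} true e =
  not-injective (trans (xor-comm true a) (trans e (xor-comm b true)))

module _ {n : ℕ} {{_ : NonZero n}} where

  ⊕-+ : (j : Fin n) (a b : ℕ) → (j ⊕ a) ⊕ b ≡ j ⊕ (a + b)
  ⊕-+ j a b = toℕ-injective (begin
    toℕ ((j ⊕ a) ⊕ b)         ≡⟨ toℕ-fromℕ< _ ⟩
    (toℕ (j ⊕ a) + b) % n     ≡⟨ cong (λ v → (v + b) % n) (toℕ-fromℕ< _) ⟩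
    ((toℕ j + a) % n + b) % n ≡⟨ [m%n+k]%n≡[m+k]%n (toℕ j + a) b n ⟩
    (toℕ j + a + b) % n       ≡⟨ cong (_% n) (+-assoc (toℕ j) a b) ⟩
    (toℕ j + (a + b)) % n     ≡⟨ toℕ-fromℕ< _ ⟨
    toℕ (j ⊕ (a + b))         ∎)

  ⊕-identityʳ : (j : Fin n) → j ⊕ 0 ≡ j
  ⊕-identityʳ j = toℕ-injective (begin
    toℕ (j ⊕ 0)       ≡⟨ toℕ-fromℕ< _ ⟩
    (toℕ j + 0) % n   ≡⟨ cong (_% n) (+-identityʳ (toℕ j)) ⟩
    toℕ j % n         ≡⟨ m<n⇒m%n≡m (toℕ<n j) ⟩
    toℕ j             ∎)

  ⊕-period : (j : Fin n) → j ⊕ n ≡ j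
  ⊕-period j = toℕ-injective (begin
    toℕ (j ⊕ n)       ≡⟨ toℕ-fromℕ< _ ⟩
    (toℕ j + n) % n   ≡⟨ [m+n]%n≡m%n (toℕ j) n ⟩
    toℕ j % n         ≡⟨ m<n⇒m%n≡m (toℕ<n j) ⟩
    toℕ j             ∎)

  C^-apply : (k : ℕ) (x : Z2^ n) (j : Fin n) → C^ k x j ≡ x (j ⊕ k)
  C^-apply zero    x j = cong x (sym (⊕-identityʳ j))
  C^-apply (suc k) x j = trans (C^-apply k x (j ⊕ 1)) (cong x (⊕-+ j 1 k))

  C^-period : (x : Z2^ n) → C^ n x ≈ x
  C^-period x j = trans (C^-apply n x j) (cong x (⊕-period j))

  C-cong : ∀ {x y : Z2^ n} → x ≈ y → C x ≈ C y
  C-cong x≈y j = x≈y (j ⊕ 1)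

  C-prod : ∀ m (f : ℕ → Z2^ n) → C (prod m f) ≈ prod m (λ j → C (f j))
  C-prod zero    f t = refl
  C-prod (suc m) f t = cong (_xor C (f m) t) (C-prod m f t)

  prod-unfoldˡ : ∀ m (f : ℕ → Z2^ n) t → prod (suc m) f t ≡ f 0 t xor prod m (λ j → f (suc j)) t
  prod-unfoldˡ zero    f t = xor-comm false (f 0 t)
  prod-unfoldˡ (suc m) f t = begin
    prod (suc m) f t xor f (suc m) t                            ≡⟨ cong (_xor f (suc m) t) (prod-unfoldˡ m f t) ⟩
    (f 0 t xor prod m (λ j → f (suc j)) t) xor f (suc m) t      ≡⟨ xor-assoc (f 0 t) _ (f (suc m) t) ⟩
    f 0 t xor prod (suc m) (λ j → f (suc j)) t                  ∎

  prod-rotate : ∀ m (f : ℕ → Z2^ n) → f m ≈ f 0 → prod m (λ j → f (suc j)) ≈ prod m f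
  prod-rotate m f fm≈f0 t = sym (xor-cancelʳ (f 0 t) (begin
    prod m f t xor f 0 t                  ≡⟨ cong (prod m f t xor_) (fm≈f0 t) ⟨
    prod (suc m) f t                      ≡⟨ prod-unfoldˡ m f t ⟩
    f 0 t xor prod m (λ j → f (suc j)) t  ≡⟨ xor-comm (f 0 t) _ ⟩
    prod m (λ j → f (suc j)) t xor f 0 t  ∎))

  module _ {I : Set} {g : I → Z2^ n} (C-gen : ∀ i → ⟨ g ⟩ (C (g i))) where

    ⟨⟩-C-closed : ∀ {x} → ⟨ g ⟩ x → ⟨ g ⟩ (C x)
    ⟨⟩-C-closed (gen i)     = C-gen i
    ⟨⟩-C-closed unit        = unit
    ⟨⟩-C-closed (mul p q)   = mul (⟨⟩-C-closed p) (⟨⟩-C-closed q)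
    ⟨⟩-C-closed (inverse p) = inverse (⟨⟩-C-closed p)
    ⟨⟩-C-closed (resp e p)  = resp (C-cong e) (⟨⟩-C-closed p)

    ⟨⟩-C^-closed : ∀ k {x} → ⟨ g ⟩ x → ⟨ g ⟩ (C^ k x)
    ⟨⟩-C^-closed zero    p = p
    ⟨⟩-C^-closed (suc k) p = ⟨⟩-C-closed (⟨⟩-C^-closed k p)

    ⟨⟩-unionOfOrbits : UnionOfOrbits ⟨ g ⟩
    ⟨⟩-unionOfOrbits x y p (k , y≈Cᵏx) = resp (λ t → sym (y≈Cᵏx t)) (⟨⟩-C^-closed k p)

module _ {n : ℕ} {{_ : NonZero n}} (d : ℕ) {{_ : NonZero d}} where

  C-A : ∀ i → C (A {n} d i) ≈ A d (suc i)
  C-A i = C-prod (n / d) (λ j → C^ (i + j * d) X)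

  A-period : d ∣ n → A {n} d d ≈ A d 0
  A-period d∣n = prod-rotate (n / d) (λ j → C^ (j * d) X) C^[n/d*d]X≈X
    where
    C^[n/d*d]X≈X : C^ (n / d * d) X ≈ X
    C^[n/d*d]X≈X rewrite m/n*n≡m d∣n = C^-period X

  A∈G : ∀ {i} → i < d → G n d (A d i)
  A∈G i<d = subst (λ v → G n d (A d v)) (toℕ-fromℕ< i<d) (gen (fromℕ< i<d))

  C-A∈G : d ∣ n → (i : Fin d) → G n d (C (A d (toℕ i)))
  C-A∈G d∣n i with suc (toℕ i) ≟ d
  ... | no  1+i≢d = resp (λ t → sym (C-A (toℕ i) t)) (A∈G (≤∧≢⇒< (toℕ<n i) 1+i≢d))
  ... | yes 1+i≡d = resp C-A-last (A∈G (>-nonZero⁻¹ d))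
    where
    C-A-last : A d 0 ≈ C (A d (toℕ i))
    C-A-last t = sym (begin
      C (A d (toℕ i)) t    ≡⟨ C-A (toℕ i) t ⟩
      A d (suc (toℕ i)) t  ≡⟨ cong (λ v → A d v t) 1+i≡d ⟩
      A d d t              ≡⟨ A-period d∣n t ⟩
      A d 0 t              ∎)

mainTheorem9 : (n : ℕ) {{_ : NonZero n}} (d : ℕ) {{_ : NonZero d}} →
    d ∣ n → UnionOfOrbits (G n d)
mainTheorem9 n d d∣n = ⟨⟩-unionOfOrbits (C-A∈G d d∣n)
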